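{- Let $k\ge 0$ be an integer and $\ell=2k$. Let $G=(X\cup Y,E)$ be a connected bipartite graph with bipartition $(X,Y)$, let $D=(<_X,<_Y)$ be a 2-layer $k$-planar drawing of $G$, and let $S\subseteq X$ be a set of $\ell+1$ vertices that appear consecutively in $<_X$. Let $x$ and $x'$ be the leftmost (smallest under $<_X$) and rightmost (largest under $<_X$) vertices of $S$. Then for each connected component $C$ of $G[V(G)\setminus N[S]]$, either all vertices of $C\cap X$ satisfy $z<_X x$, or all vertices of $C\cap X$ satisfy $x'<_X z$.
   Context: $N[S]$ denotes the closed neighborhood of $S$ (i.e., $S$ together with all vertices adjacent to a vertex of $S$), and $G[U]$ the subgraph induced by $U$. A 2-layer drawing of $G$ is a pair $(<_X,<_Y)$ of strict linear orders on $X$ and $Y$; edges $\{x,y\},\{x',y'\}$ with $x\ne x'\in X$, $y\ne y'\in Y$ cross if $x<_X x'$ and $y'<_Y y$ (or symmetrically); the drawing is $k$-planar if every edge is crossed by at most $k$ edges. -}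

module Defs where

open import Data.Nat using (ℕ; suc; _≤_; _*_)
open import Data.Fin using (Fin; fromℕ; _<_) renaming (zero to fzero)
open import Data.Sum using (_⊎_; inj₁; inj₂)
open import Data.Product using (_×_; _,_; Σ; ∃; proj₁; proj₂)
open import Data.Unit using (⊤)
open import Data.Empty using (⊥)
open import Data.List using (List; length)
open import Data.List.Relation.Unary.All using (All)
open import Data.List.Relation.Unary.Unique.Propositional using (Unique)
open import Relation.Binary.PropositionalEquality using (_≡_; _≢_)
open import Relation.Binary.Structures using (IsStrictTotalOrder)
open import Relation.Nullary using (¬_)

-- A finite bipartite graph G = (X ∪ Y, E) with X = Fin m, Y = Fin n,
-- given by its edge relation E ⊆ X × Y.
BipGraph : ℕ → ℕ → Set₁
BipGraph m n = Fin m → Fin n → Set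

V : ℕ → ℕ → Set
V m n = Fin m ⊎ Fin n

Adj : ∀ {m n} → BipGraph m n → V m n → V m n → Set
Adj E (inj₁ a) (inj₂ b) = E a b
Adj E (inj₂ b) (inj₁ a) = E a b
Adj E _ _ = ⊥

-- Walks in G all of whose vertices satisfy P (i.e. walks in G[P]).
data Reach {m n} (E : BipGraph m n) (P : V m n → Set) : V m n → V m n → Set where
  here : ∀ {v} → P v → Reach E P v v
  step : ∀ {u w v} → P u → Adj E u w → Reach E P w v → Reach E P u v

Connected : ∀ {m n} → BipGraph m n → Set
Connected {m} {n} E = (u v : V m n) → Reach E (λ _ → ⊤) u v

record Drawing (m n : ℕ) : Set₁ where
  field
    _<X_ : Fin m → Fin m → Set
    _<Y_ : Fin n → Fin n → Set
    isSTO-X : IsStrictTotalOrder _≡_ _<X_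
    isSTO-Y : IsStrictTotalOrder _≡_ _<Y_

Cross : ∀ {m n} → Drawing m n → Fin m × Fin n → Fin m × Fin n → Set
Cross D (x , y) (x' , y') =
  x ≢ x' × y ≢ y' × ((x <X x' × y' <Y y) ⊎ (x' <X x × y <Y y'))
  where open Drawing D

KPlanar : ∀ {m n} → ℕ → BipGraph m n → Drawing m n → Set
KPlanar {m} {n} k E D =
  (x : Fin m) (y : Fin n) → E x y →
  (L : List (Fin m × Fin n)) → Unique L →
  All (λ e → E (proj₁ e) (proj₂ e) × Cross D (x , y) e) L →
  length L ≤ k

record ConsecSet {m n} (D : Drawing m n) (ℓ : ℕ) (s : Fin (suc ℓ) → Fin m) : Set where
  open Drawing D
  field
    increasing  : ∀ i j → i < j → s i <X s j
    consecutive : ∀ z → s fzero <X z → z <X s (fromℕ ℓ) → ∃ λ i → z ≡ s i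

InN : ∀ {m n} → BipGraph m n → ∀ {ℓ} → (Fin (suc ℓ) → Fin m) → V m n → Set
InN E s v = (∃ λ i → v ≡ inj₁ (s i)) ⊎ (∃ λ i → Adj E (inj₁ (s i)) v)

{-# OPTIONS --safe #-}
-- A vertex y ∉ N[S] cannot have neighbours z <X s₀ and z′ >X sℓ: by connectivity
-- each of the ℓ + 1 ≥ 2k + 1 vertices of S has a neighbour, which is not y, and the
-- edge to it crosses zy or z′y according to the side of y on which that neighbour
-- lies, so one of zy, z′y is crossed more than k times. Hence the X-vertices met
-- by a walk avoiding N[S] all stay on the side of S where the walk starts.
module Submission where

open import Defs
open import Data.Nat using (ℕ; suc; _*_; _+_; _≤_; z<s)
open import Data.Nat.Properties using (+-suc; +-identityʳ; +-mono-≤; ≤⇒≯; ≤-refl; module ≤-Reasoning)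
open import Data.Fin using (Fin; fromℕ; _≟_) renaming (zero to fzero; suc to fsuc)
open import Data.Fin.Properties using (<-cmp; ≤fromℕ; ≤∧≢⇒<)
open import Data.Sum using (_⊎_; inj₁; inj₂)
import Data.Sum as Sum
open import Data.Empty using (⊥; ⊥-elim)
open import Data.Product using (_×_; _,_; ∃; proj₁; proj₂)
open import Data.List using (List; []; _∷_; length; filter; tabulate)
open import Data.List.Properties using (length-tabulate)
open import Data.List.Relation.Unary.All using (All)
import Data.List.Relation.Unary.All as All
import Data.List.Relation.Unary.All.Properties as All
open import Data.List.Relation.Unary.Unique.Propositional using (Unique)
import Data.List.Relation.Unary.Unique.Propositional.Properties as Unique
open import Relation.Binary.PropositionalEquality using (_≡_; _≢_; refl; sym; trans; cong; subst)
open import Relation.Binary.Definitions using (tri<; tri≈; tri>)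
open import Relation.Binary.Structures using (IsStrictTotalOrder)
open import Relation.Nullary using (¬_; yes; no; contradiction)
open import Relation.Unary using (Pred; Decidable)
open import Relation.Unary.Properties using (∁?)

module _ {a p} {A : Set a} {P : Pred A p} (P? : Decidable P) where

  length-filter+length-filter-∁ : ∀ xs →
    length (filter P? xs) + length (filter (∁? P?) xs) ≡ length xs
  length-filter+length-filter-∁ []       = refl
  length-filter+length-filter-∁ (x ∷ xs) with P? x
  ... | yes _ = cong suc (length-filter+length-filter-∁ xs)
  ... | no  _ = trans (+-suc _ _) (cong suc (length-filter+length-filter-∁ xs))

module _ {m n} {E : BipGraph m n} where

  Reach-head : ∀ {P u w} → Reach E P u w → P u
  Reach-head (here pu)     = pu
  Reach-head (step pu _ _) = pu

  Reach-preserves : ∀ {P Q : V m n → Set} →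
    (∀ {u w} → P u → P w → Adj E u w → Q u → Q w) →
    ∀ {u w} → Reach E P u w → Q u → Q w
  Reach-preserves preserves (here _)         qu = qu
  Reach-preserves preserves (step pu adj uw) qu =
    Reach-preserves preserves uw (preserves pu (Reach-head uw) adj qu)

  Connected⇒X-neighbour : Connected E → (x : Fin m) → Fin n → ∃ λ y → E x y
  Connected⇒X-neighbour conn x y with conn (inj₁ x) (inj₂ y)
  ... | step {w = inj₂ y′} _ exy′ _ = y′ , exy′

  Connected⇒Y-neighbour : Connected E → (y : Fin n) → Fin m → ∃ λ x → E x y
  Connected⇒Y-neighbour conn y x with conn (inj₂ y) (inj₁ x)
  ... | step {w = inj₁ x′} _ ex′y _ = x′ , ex′y

module _ {m n} {D : Drawing m n} where
  open Drawing D
  private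
    module <X = IsStrictTotalOrder isSTO-X
    module <Y = IsStrictTotalOrder isSTO-Y

  <×>⇒Cross : ∀ {x x′ y y′} → x <X x′ → y′ <Y y → Cross D (x , y) (x′ , y′)
  <×>⇒Cross x<x′ y′<y =
    (λ eq → <X.irrefl eq x<x′) , (λ eq → <Y.irrefl (sym eq) y′<y) , inj₁ (x<x′ , y′<y)

  >×<⇒Cross : ∀ {x x′ y y′} → x′ <X x → y <Y y′ → Cross D (x , y) (x′ , y′)
  >×<⇒Cross x′<x y<y′ =
    (λ eq → <X.irrefl (sym eq) x′<x) , (λ eq → <Y.irrefl eq y<y′) , inj₂ (x′<x , y<y′)

  ≮∧≢⇒>Y : ∀ {y y′} → ¬ y′ <Y y → y′ ≢ y → y <Y y′
  ≮∧≢⇒>Y {y} {y′} y′≮y y′≢y with <Y.compare y′ y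
  ... | tri< y′<y _ _ = contradiction y′<y y′≮y
  ... | tri≈ _ y′≡y _ = contradiction y′≡y y′≢y
  ... | tri> _ _ y<y′ = y<y′

  straddled-edges-≤ : ∀ {k c} {E : BipGraph m n} {z z′ y} → KPlanar k E D →
    E z y → E z′ y →
    (t : Fin c → Fin m) (u : Fin c → Fin n) → (∀ {i j} → t i ≡ t j → i ≡ j) →
    (∀ i → E (t i) (u i)) → (∀ i → u i ≢ y) →
    (∀ i → z <X t i) → (∀ i → t i <X z′) → c ≤ 2 * k
  straddled-edges-≤ {k} {c} {E} {z} {z′} {y} kp ezy ez′y t u t-inj etu u≢y z<t t<z′ =
    begin
      c
        ≡⟨ length-tabulate edge ⟨
      length edges
        ≡⟨ length-filter+length-filter-∁ below? edges ⟨
      length (filter below? edges) + length (filter (∁? below?) edges)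
        ≤⟨ +-mono-≤ (kp z y ezy _ (Unique.filter⁺ below? edges!) crossing-z)
                    (kp z′ y ez′y _ (Unique.filter⁺ (∁? below?) edges!) crossing-z′) ⟩
      k + k
        ≡⟨ cong (k +_) (+-identityʳ k) ⟨
      2 * k ∎
    where
    open ≤-Reasoning
    edge : Fin c → Fin m × Fin n
    edge i = t i , u i
    edges : List (Fin m × Fin n)
    edges = tabulate edge

    edges! : Unique edges
    edges! = Unique.tabulate⁺ (λ eq → t-inj (cong proj₁ eq))

    Below : Fin m × Fin n → Set
    Below e = proj₂ e <Y y
    below? : Decidable Below
    below? e = proj₂ e <Y.<? y

    CrossingEdge : Fin m × Fin n → Fin m × Fin n → Set
    CrossingEdge f e = E (proj₁ e) (proj₂ e) × Cross D f e

    below⇒crossing-z : All (λ e → Below e → CrossingEdge (z , y) e) edges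
    below⇒crossing-z = All.tabulate⁺ λ i u<y → etu i , <×>⇒Cross (z<t i) u<y

    above⇒crossing-z′ : All (λ e → ¬ Below e → CrossingEdge (z′ , y) e) edges
    above⇒crossing-z′ = All.tabulate⁺ λ i u≮y →
      etu i , >×<⇒Cross (t<z′ i) (≮∧≢⇒>Y u≮y (u≢y i))

    crossing-z : All (CrossingEdge (z , y)) (filter below? edges)
    crossing-z = All.zipWith (λ (cross , below) → cross below)
      (All.filter⁺ below? below⇒crossing-z , All.all-filter below? edges)

    crossing-z′ : All (CrossingEdge (z′ , y)) (filter (∁? below?) edges)
    crossing-z′ = All.zipWith (λ (cross , above) → cross above)
      (All.filter⁺ (∁? below?) above⇒crossing-z′ , All.all-filter (∁? below?) edges)

module _ {m n} {D : Drawing m n} {ℓ} {s : Fin (suc ℓ) → Fin m} (cs : ConsecSet D ℓ s) where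
  open Drawing D
  open ConsecSet cs
  private
    module <X = IsStrictTotalOrder isSTO-X

  s-injective : ∀ {i j} → s i ≡ s j → i ≡ j
  s-injective {i} {j} si≡sj with <-cmp i j
  ... | tri< i<j _ _ = contradiction (increasing i j i<j) (<X.irrefl si≡sj)
  ... | tri≈ _ i≡j _ = i≡j
  ... | tri> _ _ j<i = contradiction (increasing j i j<i) (<X.irrefl (sym si≡sj))

  <s₀⇒<s : ∀ {z} i → z <X s fzero → z <X s i
  <s₀⇒<s fzero     z<s₀ = z<s₀
  <s₀⇒<s (fsuc i) z<s₀ = <X.trans z<s₀ (increasing fzero (fsuc i) z<s)

  sℓ<⇒s< : ∀ {z} i → s (fromℕ ℓ) <X z → s i <X z
  sℓ<⇒s< i sℓ<z with i ≟ fromℕ ℓ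
  ... | yes refl = sℓ<z
  ... | no  i≢ℓ  = <X.trans (increasing i (fromℕ ℓ) (≤∧≢⇒< (≤fromℕ i) i≢ℓ)) sℓ<z

  ∉S⇒<s₀⊎sℓ< : ∀ {z} → (∀ i → z ≢ s i) → z <X s fzero ⊎ s (fromℕ ℓ) <X z
  ∉S⇒<s₀⊎sℓ< {z} z∉S with <X.compare z (s fzero)
  ... | tri< z<s₀ _ _ = inj₁ z<s₀
  ... | tri≈ _ z≡s₀ _ = contradiction z≡s₀ (z∉S fzero)
  ... | tri> _ _ s₀<z with <X.compare z (s (fromℕ ℓ))
  ...   | tri< z<sℓ _ _ = let i , z≡sᵢ = consecutive z s₀<z z<sℓ in contradiction z≡sᵢ (z∉S i)
  ...   | tri≈ _ z≡sℓ _ = contradiction z≡sℓ (z∉S (fromℕ ℓ))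
  ...   | tri> _ _ sℓ<z = inj₂ sℓ<z

module OneSide {k ℓ m n} {E : BipGraph m n} {D : Drawing m n}
  (conn : Connected E) (kp : KPlanar k E D)
  {s : Fin (suc ℓ) → Fin m} (cs : ConsecSet D ℓ s) (2k≤ℓ : 2 * k ≤ ℓ) where
  open Drawing D

  Outside : V m n → Set
  Outside u = ¬ InN E s u

  Outside⇒∉S : ∀ {z} → Outside (inj₁ z) → ∀ i → z ≢ s i
  Outside⇒∉S z∉N i z≡sᵢ = z∉N (inj₁ (i , cong inj₁ z≡sᵢ))

  Outside⇒neighbour∉S : ∀ {x y} → Outside (inj₂ y) → E x y → ∀ i → x ≢ s i
  Outside⇒neighbour∉S y∉N exy i refl = y∉N (inj₂ (i , exy))

  no-straddling : ∀ {y z z′} → Outside (inj₂ y) → E z y → E z′ y →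
    z <X s fzero → s (fromℕ ℓ) <X z′ → ⊥
  no-straddling {y} y∉N ezy ez′y z<s₀ sℓ<z′ =
    ≤⇒≯ 2k≤ℓ (straddled-edges-≤ {D = D} kp ezy ez′y s u (s-injective cs) esu u≢y
                (λ i → <s₀⇒<s cs i z<s₀) (λ i → sℓ<⇒s< cs i sℓ<z′))
    where
    u : Fin (suc ℓ) → Fin n
    u i = proj₁ (Connected⇒X-neighbour conn (s i) y)
    esu : ∀ i → E (s i) (u i)
    esu i = proj₂ (Connected⇒X-neighbour conn (s i) y)
    u≢y : ∀ i → u i ≢ y
    u≢y i uᵢ≡y = y∉N (inj₂ (i , subst (E (s i)) uᵢ≡y (esu i)))

  OnSide : (Fin m → Set) → V m n → Set
  OnSide Side (inj₁ x) = Side x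
  OnSide Side (inj₂ y) = ∃ λ x → E x y × Side x

  Stable : (Fin m → Set) → Set
  Stable Side = ∀ {x x′ y} → Outside (inj₂ y) → Outside (inj₁ x′) →
    E x y → E x′ y → Side x → Side x′

  OnSide-preserved : ∀ {Side} → Stable Side → ∀ {u w} → Outside u → Outside w →
    Adj E u w → OnSide Side u → OnSide Side w
  OnSide-preserved stable {inj₁ x} {inj₂ y} _   _    exy  side-x = x , exy , side-x
  OnSide-preserved stable {inj₂ y} {inj₁ x′} y∉N x′∉N ex′y (x , exy , side-x) =
    stable y∉N x′∉N exy ex′y side-x

  LeftOfS RightOfS : Fin m → Set
  LeftOfS z = z <X s fzero
  RightOfS z = s (fromℕ ℓ) <X z

  LeftOfS-stable : Stable LeftOfS
  LeftOfS-stable y∉N x′∉N exy ex′y x<s₀ with ∉S⇒<s₀⊎sℓ< cs (Outside⇒∉S x′∉N)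
  ... | inj₁ x′<s₀ = x′<s₀
  ... | inj₂ sℓ<x′ = ⊥-elim (no-straddling y∉N exy ex′y x<s₀ sℓ<x′)

  RightOfS-stable : Stable RightOfS
  RightOfS-stable y∉N x′∉N exy ex′y sℓ<x with ∉S⇒<s₀⊎sℓ< cs (Outside⇒∉S x′∉N)
  ... | inj₁ x′<s₀ = ⊥-elim (no-straddling y∉N ex′y exy x′<s₀ sℓ<x)
  ... | inj₂ sℓ<x′ = sℓ<x′

  Outside⇒OnSide : ∀ v → Outside v → OnSide LeftOfS v ⊎ OnSide RightOfS v
  Outside⇒OnSide (inj₁ z) z∉N = ∉S⇒<s₀⊎sℓ< cs (Outside⇒∉S z∉N)
  Outside⇒OnSide (inj₂ y) y∉N =
    let x , exy = Connected⇒Y-neighbour conn y (s fzero)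
    in Sum.map (λ left → x , exy , left) (λ right → x , exy , right)
                (∉S⇒<s₀⊎sℓ< cs (Outside⇒neighbour∉S y∉N exy))

  component-on-one-side : ∀ v → Outside v →
    (∀ z → Reach E Outside v (inj₁ z) → LeftOfS z) ⊎
    (∀ z → Reach E Outside v (inj₁ z) → RightOfS z)
  component-on-one-side v v∉N =
    Sum.map (λ left  _ v⇝z → Reach-preserves (OnSide-preserved LeftOfS-stable)  v⇝z left)
            (λ right _ v⇝z → Reach-preserves (OnSide-preserved RightOfS-stable) v⇝z right)
            (Outside⇒OnSide v v∉N)

lemma8 : (k m n : ℕ) (E : BipGraph m n) (D : Drawing m n) →
    Connected E → KPlanar k E D →
    (s : Fin (suc (2 * k)) → Fin m) → ConsecSet D (2 * k) s →
    (v : V m n) → ¬ InN E s v →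
    ((z : Fin m) → Reach E (λ u → ¬ InN E s u) v (inj₁ z) →
        Drawing._<X_ D z (s fzero))
    ⊎
    ((z : Fin m) → Reach E (λ u → ¬ InN E s u) v (inj₁ z) →
        Drawing._<X_ D (s (fromℕ (2 * k))) z)
lemma8 k m n E D conn kp s cs = OneSide.component-on-one-side conn kp cs ≤-refl
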